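{- In the $F_4$ Black Hole Zeckendorf game, for $\alpha,\gamma\in\mathbb{Z}_{\ge0}$: (1) $(3\alpha,1,4\gamma)$ is a $P$ position for all $\alpha\le\gamma$ and an $N$ position for all $\alpha\ge\gamma+1$; (2) $(3\alpha,1,4\gamma+1)$ is a $P$ position for all $\alpha\le\gamma-1$ and an $N$ position for all $\alpha\ge\gamma$; (3) $(3\alpha,1,4\gamma+2)$ is a $P$ position for all $\alpha\le\gamma-2$ and an $N$ position for all $\alpha\ge\gamma-1$; (4) $(3\alpha,1,4\gamma+3)$ is a $P$ position for all $\alpha\le\gamma+2$ and an $N$ position for all $\alpha\ge\gamma+3$.
   Context: The $F_4$ Black Hole Zeckendorf game: a position is a triple $(a,b,c)$ of nonnegative integers, the numbers of pieces in the columns of weights $F_1=1$, $F_2=2$, $F_3=3$. Two players alternate moves; the available moves are: (M) if $a\ge2$, go to $(a-2,b+1,c)$; (A$_1$) if $a,b\ge1$, go to $(a-1,b-1,c+1)$; (A$_2$) if $b,c\ge1$, go to $(a,b-1,c-1)$; (S$_2$) if $b\ge2$, go to $(a+1,b-2,c+1)$; (S$_3$) if $c\ge2$, go to $(a+1,b,c-2)$ (pieces landing in column $F_4=5$, the "black hole", are removed). The player making the last move wins. A position is a $P$ position if the player to move from it loses under optimal play, and an $N$ position if the player to move can force a win; positions with no move are $P$ positions. -}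

module Defs where

open import Data.Nat using (ℕ; zero; suc; _+_; _*_)
open import Data.Product using (_×_; _,_; ∃)

-- A position (a , b , c): pieces in columns of weights F₁=1, F₂=2, F₃=3.
Position : Set
Position = ℕ × ℕ × ℕ

data _⟶_ : Position → Position → Set where
  M  : ∀ {a b c} → (suc (suc a) , b , c) ⟶ (a , suc b , c)
  A₁ : ∀ {a b c} → (suc a , suc b , c) ⟶ (a , b , suc c)
  A₂ : ∀ {a b c} → (a , suc b , suc c) ⟶ (a , b , c)
  S₂ : ∀ {a b c} → (a , suc (suc b) , c) ⟶ (suc a , b , suc c)
  S₃ : ∀ {a b c} → (a , b , suc (suc c)) ⟶ (suc a , b , c)

-- A position is P iff every move leads to an N position (in particular, a
-- position with no moves is P); it is N iff some move leads to a P position.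
-- (The game terminates, so the inductive reading is the standard one.)
mutual
  data IsP (p : Position) : Set where
    allN : (∀ {q} → p ⟶ q → IsN q) → IsP p

  data IsN (p : Position) : Set where
    someP : ∀ {q} → p ⟶ q → IsP q → IsN p

-- The P-positions with at most one piece in the middle column form an explicit,
-- eventually periodic table `candidate`.  From a candidate every move can be answered
-- by a move back into a candidate; as the potential 2a + 3b + 2c drops with every
-- move, this closure property alone makes every candidate a P-position.  Closure is
-- checked by evaluation: near the two axes the check is eventually independent of the far
-- coordinate, and elsewhere the table, hence the check, is invariant under
-- (a , c) ↦ (a + 3 , c + 4).  The same translation moves (3α , 1 , 4γ + r) to the
-- row a = 0 or to the columns c ≤ 3, where the table is read off; the N-positions
-- are witnessed by an A₁ or A₂ move into the table.

module Submission where

open import Defs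
open import Data.Bool using (Bool; true; false; T; not; _∨_; _∧_; if_then_else_)
open import Data.Bool.ListAction using (any; all)
open import Data.Bool.Properties using (T-∧)
open import Data.List using (List; []; _∷_; [_]; _++_)
open import Data.List.Membership.Propositional using (_∈_)
open import Data.List.Membership.Propositional.Properties using (∈-++⁺ʳ)
open import Data.List.Relation.Unary.All as All using ()
open import Data.List.Relation.Unary.All.Properties using (all⁺)
open import Data.List.Relation.Unary.Any using (here; satisfied)
open import Data.List.Relation.Unary.Any.Properties using (any⁻)
open import Data.Nat using (ℕ; zero; suc; _+_; _*_; _≤_; _<_; _≡ᵇ_; _<ᵇ_; z≤n; s≤s; z<s; _<?_)
open import Data.Nat.Induction using (<-wellFounded; <-rec)
open import Data.Nat.Properties using (*-comm; +-comm; m<n+m; ≮⇒≥; m≤n⇒∃[o]m+o≡n; allUpTo?)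
open import Data.Nat.Tactic.RingSolver using (solve)
open import Data.Product using (Σ; ∃-syntax; _×_; _,_; proj₁; proj₂)
open import Data.Unit using (tt)
open import Function using (_∘_; Equivalence)
open import Induction.WellFounded using (WellFounded; Acc; acc; module Subrelation)
open import Relation.Binary.Construct.On as On using ()
open import Relation.Binary.PropositionalEquality using (_≡_; refl; sym; subst)
open import Relation.Nullary using (yes; no)
open import Relation.Nullary.Decidable using (T?; from-yes)

potential : Position → ℕ
potential (a , b , c) = 2 * a + 3 * b + 2 * c

<-by-gap : ∀ m n k → n ≡ suc k + m → m < n
<-by-gap m _ k refl = m<n+m m {suc k} z<s

potential-decreasing : ∀ {p q} → p ⟶ q → potential q < potential p
potential-decreasing (M {a} {b} {c}) =
  <-by-gap (2 * a + 3 * suc b + 2 * c) (2 * suc (suc a) + 3 * b + 2 * c) 0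
    (solve (a ∷ b ∷ c ∷ []))
potential-decreasing (A₁ {a} {b} {c}) =
  <-by-gap (2 * a + 3 * b + 2 * suc c) (2 * suc a + 3 * suc b + 2 * c) 2
    (solve (a ∷ b ∷ c ∷ []))
potential-decreasing (A₂ {a} {b} {c}) =
  <-by-gap (2 * a + 3 * b + 2 * c) (2 * a + 3 * suc b + 2 * suc c) 4
    (solve (a ∷ b ∷ c ∷ []))
potential-decreasing (S₂ {a} {b} {c}) =
  <-by-gap (2 * suc a + 3 * b + 2 * suc c) (2 * a + 3 * suc (suc b) + 2 * c) 1
    (solve (a ∷ b ∷ c ∷ []))
potential-decreasing (S₃ {a} {b} {c}) =
  <-by-gap (2 * suc a + 3 * b + 2 * c) (2 * a + 3 * b + 2 * suc (suc c)) 1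
    (solve (a ∷ b ∷ c ∷ []))

_⟵_ : Position → Position → Set
q ⟵ p = p ⟶ q

⟵-wellFounded : WellFounded _⟵_
⟵-wellFounded = Subrelation.wellFounded potential-decreasing (On.wellFounded potential <-wellFounded)

module _ (S : Position → Set) (S-closed : ∀ {p q} → S p → p ⟶ q → ∃[ r ] (q ⟶ r × S r)) where

  closed⇒IsP : ∀ {p} → S p → IsP p
  closed⇒IsP {p} = fromAcc (⟵-wellFounded p)
    where
    fromAcc : ∀ {p} → Acc _⟵_ p → S p → IsP p
    answer : ∀ {q} → Acc _⟵_ q → ∃[ r ] (q ⟶ r × S r) → IsN q
    fromAcc (acc rec) sp = allN λ mv → answer (rec mv) (S-closed sp mv)
    answer (acc rec) (_ , mv , sr) = someP mv (fromAcc (rec mv) sr)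

-- Only candidate ⇒ IsP is proved; the converse fails for b ≥ 2, e.g. at the
-- P-position (0 , 2 , 2).
candidate : Position → Bool
candidate (_ , suc (suc _) , _) = false
candidate (suc (suc (suc a)) , b , suc (suc (suc (suc c)))) = candidate (a , b , c)
candidate (0 , 0 , c) = (c ≡ᵇ 0) ∨ (c ≡ᵇ 1) ∨ (c ≡ᵇ 5)
candidate (1 , 0 , c) = not (c ≡ᵇ 3)
candidate (2 , 0 , c) = c ≡ᵇ 1
candidate (_ , 0 , c) = c <ᵇ 2
candidate (0 , 1 , c) = not ((c ≡ᵇ 1) ∨ (c ≡ᵇ 2) ∨ (c ≡ᵇ 6))
candidate (3 , 1 , 3) = true
candidate (6 , 1 , 3) = true
candidate _ = false

Successor : Position → Set
Successor p = Σ Position (p ⟶_)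

viaM viaA₁ viaA₂ viaS₂ viaS₃ : (p : Position) → List (Successor p)
viaM (suc (suc a) , b , c) = [ _ , M ]
viaM _ = []
viaA₁ (suc a , suc b , c) = [ _ , A₁ ]
viaA₁ _ = []
viaA₂ (a , suc b , suc c) = [ _ , A₂ ]
viaA₂ _ = []
viaS₂ (a , suc (suc b) , c) = [ _ , S₂ ]
viaS₂ _ = []
viaS₃ (a , b , suc (suc c)) = [ _ , S₃ ]
viaS₃ _ = []

successors : (p : Position) → List (Successor p)
successors p = viaM p ++ viaA₁ p ++ viaA₂ p ++ viaS₂ p ++ viaS₃ p

∈-successors : ∀ {p q} (mv : p ⟶ q) → (q , mv) ∈ successors p
∈-successors M = here refl
∈-successors (A₁ {a} {b} {c}) = ∈-++⁺ʳ (viaM p) (here refl)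
  where p = (suc a , suc b , c)
∈-successors (A₂ {a} {b} {c}) = ∈-++⁺ʳ (viaM p) (∈-++⁺ʳ (viaA₁ p) (here refl))
  where p = (a , suc b , suc c)
∈-successors (S₂ {a} {b} {c}) =
  ∈-++⁺ʳ (viaM p) (∈-++⁺ʳ (viaA₁ p) (∈-++⁺ʳ (viaA₂ p) (here refl)))
  where p = (a , suc (suc b) , c)
∈-successors (S₃ {a} {b} {c}) =
  ∈-++⁺ʳ (viaM p) (∈-++⁺ʳ (viaA₁ p) (∈-++⁺ʳ (viaA₂ p) (∈-++⁺ʳ (viaS₂ p) (here refl))))
  where p = (a , b , suc (suc c))

movesToCandidate : Position → Bool
movesToCandidate p = any (candidate ∘ proj₁) (successors p)

closedAt : Position → Bool
closedAt p = if candidate p then all (movesToCandidate ∘ proj₁) (successors p) else true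

closedAt-sound : ∀ p → T (closedAt p) → T (candidate p) →
                 T (all (movesToCandidate ∘ proj₁) (successors p))
closedAt-sound p closed cp with candidate p
... | true = closed

closedAt₀₁ : ℕ → ℕ → Bool
closedAt₀₁ a c = closedAt (a , 0 , c) ∧ closedAt (a , 1 , c)

-- Within two moves of (7 + a , b , 8 + c) every position has a ≥ 3 and c ≥ 4, where
-- candidate is translation invariant, so both sides normalise to the same term.
closedAt₀₁-diagonal : ∀ a c → closedAt₀₁ (7 + a) (8 + c) ≡ closedAt₀₁ (4 + a) (4 + c)
closedAt₀₁-diagonal a c = refl

split-at : ∀ n {P : ℕ → Set} → (∀ {m} → m < n → P m) → (∀ k → P (n + k)) → ∀ m → P m
split-at n below from m with m <? n
... | yes m<n = below m<n
... | no m≮n with k , refl ← m≤n⇒∃[o]m+o≡n (≮⇒≥ m≮n) = from k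

-- 15 and 10 are the least offsets beyond which the check evaluates with the far
-- coordinate left symbolic.
closedAt₀₁-a<7 : ∀ {a} → a < 7 → ∀ c → T (closedAt₀₁ a c)
closedAt₀₁-a<7 a<7 = split-at 15 (below a<7) (λ k → from k a<7)
  where
  below : ∀ {a} → a < 7 → ∀ {c} → c < 15 → T (closedAt₀₁ a c)
  below = from-yes (allUpTo? (λ a → allUpTo? (λ c → T? (closedAt₀₁ a c)) 15) 7)
  from : ∀ k {a} → a < 7 → T (closedAt₀₁ a (15 + k))
  from k = from-yes (allUpTo? (λ a → T? (closedAt₀₁ a (15 + k))) 7)

closedAt₀₁-c<8 : ∀ a {c} → c < 8 → T (closedAt₀₁ a c)
closedAt₀₁-c<8 a c<8 = split-at 10 (λ a<10 → below a<10 c<8) (λ k → from k c<8) a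
  where
  below : ∀ {a} → a < 10 → ∀ {c} → c < 8 → T (closedAt₀₁ a c)
  below = from-yes (allUpTo? (λ a → allUpTo? (λ c → T? (closedAt₀₁ a c)) 8) 10)
  from : ∀ k {c} → c < 8 → T (closedAt₀₁ (10 + k) c)
  from k = from-yes (allUpTo? (λ c → T? (closedAt₀₁ (10 + k) c)) 8)

closedAt₀₁-everywhere : ∀ a c → T (closedAt₀₁ a c)
closedAt₀₁-everywhere = <-rec _ step
  where
  step : ∀ a → (∀ {a′} → a′ < a → ∀ c → T (closedAt₀₁ a′ c)) → ∀ c → T (closedAt₀₁ a c)
  step = split-at 7 (λ a<7 _ → closedAt₀₁-a<7 a<7) λ k rec →
    split-at 8 (closedAt₀₁-c<8 (7 + k)) λ l →
      subst T (sym (closedAt₀₁-diagonal k l)) (rec (m<n+m (4 + k) {3} z<s) (4 + l))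

closedAt-everywhere : ∀ p → T (closedAt p)
closedAt-everywhere (a , 0 , c) = proj₁ (Equivalence.to T-∧ (closedAt₀₁-everywhere a c))
closedAt-everywhere (a , 1 , c) = proj₂ (Equivalence.to T-∧ (closedAt₀₁-everywhere a c))
closedAt-everywhere (a , suc (suc b) , c) = tt

candidate-closed : ∀ {p q} → T (candidate p) → p ⟶ q → ∃[ r ] (q ⟶ r × T (candidate r))
candidate-closed {p} {q} cp mv =
  let (r , mv′) , cr = satisfied (any⁻ (candidate ∘ proj₁) (successors q) answered) in r , mv′ , cr
  where
  answered : T (movesToCandidate q)
  answered = All.lookup (all⁺ _ (successors p) (closedAt-sound p (closedAt-everywhere p) cp))
                        (∈-successors mv)

candidate⇒IsP : ∀ {p} → T (candidate p) → IsP p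
candidate⇒IsP = closed⇒IsP (T ∘ candidate) candidate-closed

candidate[3α,1,4γ] : ∀ {α γ} → α ≤ γ → T (candidate (α * 3 , 1 , γ * 4))
candidate[3α,1,4γ] {γ = zero} z≤n = tt
candidate[3α,1,4γ] {γ = suc zero} z≤n = tt
candidate[3α,1,4γ] {γ = suc (suc _)} z≤n = tt
candidate[3α,1,4γ] (s≤s α≤γ) = candidate[3α,1,4γ] α≤γ

candidate[3α,1,4γ+1] : ∀ {α γ} → suc α ≤ γ → T (candidate (α * 3 , 1 , 1 + γ * 4))
candidate[3α,1,4γ+1] {zero} {suc zero} _ = tt
candidate[3α,1,4γ+1] {zero} {suc (suc _)} _ = tt
candidate[3α,1,4γ+1] {suc α} (s≤s α<γ) = candidate[3α,1,4γ+1] α<γ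

candidate[3α,1,4γ+2] : ∀ {α γ} → 2 + α ≤ γ → T (candidate (α * 3 , 1 , 2 + γ * 4))
candidate[3α,1,4γ+2] {zero} {suc (suc _)} _ = tt
candidate[3α,1,4γ+2] {zero} {suc zero} (s≤s ())
candidate[3α,1,4γ+2] {suc α} (s≤s 2+α≤γ) = candidate[3α,1,4γ+2] 2+α≤γ

candidate[3α,1,4γ+3] : ∀ {α γ} → α ≤ 2 + γ → T (candidate (α * 3 , 1 , 3 + γ * 4))
candidate[3α,1,4γ+3] {zero} {zero} _ = tt
candidate[3α,1,4γ+3] {zero} {suc _} _ = tt
candidate[3α,1,4γ+3] {1} {zero} _ = tt
candidate[3α,1,4γ+3] {2} {zero} _ = tt
candidate[3α,1,4γ+3] {suc (suc (suc _))} {zero} (s≤s (s≤s ()))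
candidate[3α,1,4γ+3] {suc α} {suc γ} (s≤s α≤2+γ) = candidate[3α,1,4γ+3] α≤2+γ

N[3α,1,4γ] : ∀ {α γ} → suc γ ≤ α → IsN (α * 3 , 1 , γ * 4)
N[3α,1,4γ] (s≤s γ≤α) = someP A₁ (candidate⇒IsP (target γ≤α))
  where
  target : ∀ {α γ} → γ ≤ α → T (candidate (2 + α * 3 , 0 , 1 + γ * 4))
  target {zero} z≤n = tt
  target {suc _} z≤n = tt
  target (s≤s γ≤α) = target γ≤α

N[3α,1,4γ+1] : ∀ {α γ} → γ ≤ α → IsN (α * 3 , 1 , 1 + γ * 4)
N[3α,1,4γ+1] γ≤α = someP A₂ (candidate⇒IsP (target γ≤α))
  where
  target : ∀ {α γ} → γ ≤ α → T (candidate (α * 3 , 0 , γ * 4))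
  target {zero} z≤n = tt
  target {suc _} z≤n = tt
  target (s≤s γ≤α) = target γ≤α

N[3α,1,4γ+2] : ∀ {α γ} → γ ≤ suc α → IsN (α * 3 , 1 , 2 + γ * 4)
N[3α,1,4γ+2] γ≤1+α = someP A₂ (candidate⇒IsP (target γ≤1+α))
  where
  target : ∀ {α γ} → γ ≤ suc α → T (candidate (α * 3 , 0 , 1 + γ * 4))
  target {zero} {zero} z≤n = tt
  target {suc _} {zero} z≤n = tt
  target {zero} {suc zero} _ = tt
  target {zero} {suc (suc _)} (s≤s ())
  target {suc α} {suc γ} (s≤s γ≤1+α) = target γ≤1+α

N[3α,1,4γ+3] : ∀ {α γ} → 3 + γ ≤ α → IsN (α * 3 , 1 , 3 + γ * 4)
N[3α,1,4γ+3] (s≤s 2+γ≤α) = someP A₁ (candidate⇒IsP (target 2+γ≤α))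
  where
  target : ∀ {α γ} → 2 + γ ≤ α → T (candidate (2 + α * 3 , 0 , 4 + γ * 4))
  target {suc (suc _)} {zero} _ = tt
  target {suc _} {suc _} (s≤s 2+γ≤α) = target 2+γ≤α

theorem5p13 : (α γ : ℕ) →
    ((α ≤ γ → IsP (3 * α , 1 , 4 * γ)) ×
     (γ + 1 ≤ α → IsN (3 * α , 1 , 4 * γ))) ×
    ((α + 1 ≤ γ → IsP (3 * α , 1 , 4 * γ + 1)) ×
     (γ ≤ α → IsN (3 * α , 1 , 4 * γ + 1))) ×
    ((α + 2 ≤ γ → IsP (3 * α , 1 , 4 * γ + 2)) ×
     (γ ≤ α + 1 → IsN (3 * α , 1 , 4 * γ + 2))) ×
    ((α ≤ γ + 2 → IsP (3 * α , 1 , 4 * γ + 3)) ×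
     (γ + 3 ≤ α → IsN (3 * α , 1 , 4 * γ + 3)))
-- Adding constants on the left and multiplying by them on the right exposes the
-- `suc`s on which the moves and candidate compute.
theorem5p13 α γ
  rewrite *-comm 3 α | *-comm 4 γ
        | +-comm (γ * 4) 1 | +-comm (γ * 4) 2 | +-comm (γ * 4) 3
        | +-comm γ 1 | +-comm α 1 | +-comm α 2 | +-comm γ 2 | +-comm γ 3 =
  (candidate⇒IsP ∘ candidate[3α,1,4γ]   , N[3α,1,4γ]) ,
  (candidate⇒IsP ∘ candidate[3α,1,4γ+1] , N[3α,1,4γ+1]) ,
  (candidate⇒IsP ∘ candidate[3α,1,4γ+2] , N[3α,1,4γ+2]) ,
  (candidate⇒IsP ∘ candidate[3α,1,4γ+3] , N[3α,1,4γ+3])
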